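{- For every integer $k\geq 4$, the board $[20]\times[10k+4]$ admits a $(2,5)$ knight's tour.
   Context: $[m]=\{0,\dots,m-1\}$. The $(2,5)$ knight's graph on $[p]\times[q]$ has vertex set $[p]\times[q]$, with $(x,y)\sim(x',y')$ iff $\{|x-x'|,|y-y'|\}=\{2,5\}$; a $(2,5)$ knight's tour is a Hamiltonian cycle of it. -}

module Defs where

open import Data.Nat using (ℕ; zero; suc; _+_; _*_; _∸_; _≤_; _<?_; s≤s)
open import Relation.Nullary using (yes; no)
open import Data.Fin using (Fin; toℕ; fromℕ<; zero; suc)
open import Data.Product using (_×_; _,_; Σ; ∃; ∃-syntax)
open import Data.Sum using (_⊎_)
open import Relation.Binary.PropositionalEquality using (_≡_)
open import Function.Definitions using (Injective; Surjective)

∣_-_∣ : ℕ → ℕ → ℕ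
∣ a - b ∣ = (a ∸ b) + (b ∸ a)

Cell : ℕ → ℕ → Set
Cell p q = Fin p × Fin q

Leap : ℕ → ℕ → {p q : ℕ} → Cell p q → Cell p q → Set
Leap a b (x , y) (x' , y') =
  (∣ toℕ x - toℕ x' ∣ ≡ a × ∣ toℕ y - toℕ y' ∣ ≡ b)
  ⊎ (∣ toℕ x - toℕ x' ∣ ≡ b × ∣ toℕ y - toℕ y' ∣ ≡ a)

cycSuc : {n : ℕ} → Fin n → Fin n
cycSuc {suc n} i with toℕ i <? n
... | yes i<n = fromℕ< (s≤s i<n)
... | no _    = zero

-- A Hamiltonian cycle of the (a,b)-knight's graph on [p] × [q]:
-- a cyclic ordering of all p*q cells (a bijection Fin (p*q) → cells)
-- in which cyclically consecutive cells are adjacent.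
record KnightTour (a b p q : ℕ) : Set where
  field
    tour     : Fin (p * q) → Cell p q
    injTour  : Injective _≡_ _≡_ tour
    surjTour : Surjective _≡_ _≡_ tour
    adjTour  : ∀ i → Leap a b (tour i) (tour (cycSuc i))

-- With k = m + 4 the board is [20] × [w] for w = 44 + 10m. A fixed (2,5)-path `anchor` of 356 cells runs
-- from (8,1) to (16,8), and a path `filler m` from (18,13) to (13,3) covers all other cells; the moves
-- (16,8) → (18,13) and (13,3) → (8,1) close the tour. The path `filler (m + 1)` is `filler m` shifted by 10
-- in the second coordinate, preceded by `entry` and followed by `exit`. This works because the cells of
-- anchor, entry and exit are exactly the cells with second coordinate < 10 together with the anchor
-- shifted by 10, so by induction anchor ++ filler m is a permutation of the cells of the board. Both finite
-- permutation facts (the base case m = 0 and this one) are checked by evaluating merge sort.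

module Submission where

open import Defs
open import Level using (Level; _⊔_; 0ℓ)
open import Function.Base using (id; _∘_)
open import Function.Definitions using (Injective; Surjective)
open import Data.Empty using (⊥; ⊥-elim)
open import Data.Nat using (ℕ; zero; suc; _+_; _*_; _<_; _≤_; s≤s; z<s; s<s; s≤s⁻¹; s<s⁻¹)
open import Data.Nat.Properties
  using (_≟_; _<?_; ≤-decTotalOrder; +-cancelˡ-≡; *-suc; *-zeroʳ; ≤-antisym; ≮⇒≥; suc-injective; [m+n]∸[m+o]≡n∸o; m≤n⇒∃[o]m+o≡n)
open import Data.Fin using (Fin; toℕ; fromℕ<; cast; zero; suc)
open import Data.Fin.Properties using (toℕ<n; toℕ-injective; toℕ-fromℕ<; cast-is-id; cast-involutive)
open import Data.Product using (_×_; _,_; proj₁; proj₂)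
open import Data.Product.Relation.Binary.Lex.NonStrict using (×-decTotalOrder)
open import Data.Sum using (_⊎_; inj₁; inj₂)
open import Data.Maybe as Maybe using (just)
open import Data.Maybe.Properties using (just-injective)
open import Data.Maybe.Relation.Binary.Connected using (Connected; just)
open import Data.List using (List; []; _∷_; _++_; map; length; lookup; upTo; head; last)
open import Data.List.Properties using (map-id; map-++; map-∘; ++-assoc; length-++; length-map; length-upTo; last-map)
open import Data.List.Membership.Propositional using (_∈_)
open import Data.List.Membership.Propositional.Properties using (∈-map⁺; ∈-map⁻; ∈-++⁺ˡ; ∈-++⁺ʳ; ∈-upTo⁺; ∈-lookup)
open import Data.List.Relation.Unary.All as All using (All; []; _∷_)
import Data.List.Relation.Unary.All.Properties as All
import Data.List.Relation.Unary.Any as Any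
open import Data.List.Relation.Unary.Any.Properties using (lookup-index)
open import Data.List.Relation.Unary.Linked as Linked using (Linked; []; [-]; _∷_; linked?)
import Data.List.Relation.Unary.Linked.Properties as Linked
open import Data.List.Relation.Unary.Unique.Propositional using (Unique; []; _∷_)
import Data.List.Relation.Unary.Unique.Propositional.Properties as Unique
open import Data.List.Relation.Binary.Permutation.Propositional
  using (_↭_; ↭-sym; ↭-trans; ↭⇒↭ₛ; module PermutationReasoning)
open import Data.List.Relation.Binary.Permutation.Propositional.Properties using (↭-length; ∈-resp-↭; ++⁺ˡ; ++⁺ʳ; ++-comm)
import Data.List.Relation.Binary.Permutation.Propositional.Properties as Perm
open import Data.List.Relation.Binary.Permutation.Setoid.Properties using (Unique-resp-↭)
open import Data.List.Sort.MergeSort.Base (×-decTotalOrder ≤-decTotalOrder ≤-decTotalOrder) using (sort)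
open import Data.List.Sort.MergeSort.Properties (×-decTotalOrder ≤-decTotalOrder ≤-decTotalOrder) using (sort-↭)
open import Data.Nat.Tactic.RingSolver using (solve-∀)
open import Relation.Binary.Core using (Rel)
open import Relation.Binary.Definitions using (Decidable)
open import Relation.Binary.PropositionalEquality
  using (_≡_; refl; sym; trans; cong; cong₂; subst; subst₂; setoid; module ≡-Reasoning)
open import Relation.Nullary using (yes; no)
open import Relation.Nullary.Decidable using (from-yes; _×-dec_; _⊎-dec_)

private
  variable
    a b ℓ ℓ′ : Level
    A : Set a
    B : Set b

record Walk {A : Set a} (R : Rel A ℓ) (s t : A) (xs : List A) : Set (a ⊔ ℓ) where
  field
    steps : Linked R xs
    first : head xs ≡ just s
    final : last xs ≡ just t

open Walk

last-++ : ∀ (xs : List A) y ys → last (xs ++ y ∷ ys) ≡ last (y ∷ ys)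
last-++ []            y ys = refl
last-++ (x ∷ [])      y ys = refl
last-++ (x ∷ x′ ∷ xs) y ys = last-++ (x′ ∷ xs) y ys

last≡lookup : ∀ (x : A) ys (i : Fin (suc (length ys))) → toℕ i ≡ length ys →
              last (x ∷ ys) ≡ just (lookup (x ∷ ys) i)
last≡lookup x []       zero    _ = refl
last≡lookup x (y ∷ ys) (suc i) e = last≡lookup y ys i (suc-injective e)

lookup-injective : ∀ {xs : List A} → Unique xs → Injective _≡_ _≡_ (lookup xs)
lookup-injective (_ ∷ _)  {zero}  {zero}  _ = refl
lookup-injective (x≢ ∷ _) {zero}  {suc j} e = ⊥-elim (All.lookup x≢ (∈-lookup j) e)
lookup-injective (x≢ ∷ _) {suc i} {zero}  e = ⊥-elim (All.lookup x≢ (∈-lookup i) (sym e))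
lookup-injective (_ ∷ u)  {suc i} {suc j} e = cong suc (lookup-injective u e)

cast-cycSuc : ∀ {m n} (e : m ≡ n) (i : Fin m) → cast e (cycSuc i) ≡ cycSuc (cast e i)
cast-cycSuc refl i = trans (cast-is-id refl (cycSuc i)) (cong cycSuc (sym (cast-is-id refl i)))

module _ {R : Rel A ℓ} where

  walk-++ : ∀ {s t u v xs ys} → Walk R s t xs → R t u → Walk R u v ys → Walk R s v (xs ++ ys)
  walk-++ {xs = x ∷ xs} {ys = y ∷ ys} p t↝u q = record
    { steps = Linked.++⁺ (steps p) connected (steps q)
    ; first = first p
    ; final = trans (last-++ (x ∷ xs) y ys) (final q)
    }
    where
    connected : Connected R (last (x ∷ xs)) (head (y ∷ ys))
    connected = subst₂ (Connected R) (sym (final p)) (sym (first q)) (just t↝u)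

  walk-map : ∀ {R′ : Rel B ℓ′} {f : B → A} → (∀ {u v} → R′ u v → R (f u) (f v)) →
             ∀ {s t xs} → Walk R′ s t xs → Walk R (f s) (f t) (map f xs)
  walk-map {f = f} f-mono {xs = x ∷ xs} p = record
    { steps = Linked.map⁺ (Linked.map f-mono (steps p))
    ; first = cong (just ∘ f) (just-injective (first p))
    ; final = trans (last-map f (x ∷ xs)) (cong (Maybe.map f) (final p))
    }

  Linked-lookup-suc : ∀ {xs} → Linked R xs → ∀ (i j : Fin (length xs)) → toℕ j ≡ suc (toℕ i) →
                      R (lookup xs i) (lookup xs j)
  Linked-lookup-suc (r ∷ _)  zero    (suc zero) _ = r
  Linked-lookup-suc (_ ∷ rs) (suc i) (suc j)    e = Linked-lookup-suc rs i j (suc-injective e)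

  -- The split on toℕ i <? length ys is the one in the definition of cycSuc.
  walk-lookup-cycSuc : ∀ {s t xs} → Walk R s t xs → R t s →
                       ∀ i → R (lookup xs i) (lookup xs (cycSuc i))
  walk-lookup-cycSuc {xs = x ∷ ys} w t↝s i with toℕ i <? length ys
  ... | yes i<n = Linked-lookup-suc (steps w) i (fromℕ< (s≤s i<n)) (toℕ-fromℕ< (s≤s i<n))
  ... | no  i≮n = subst₂ R (just-injective (trans (sym (final w)) (last≡lookup x ys i i≡n)))
                           (sym (just-injective (first w))) t↝s
    where
    i≡n : toℕ i ≡ length ys
    i≡n = ≤-antisym (s≤s⁻¹ (toℕ<n i)) (≮⇒≥ i≮n)

Pos : Set
Pos = ℕ × ℕ

Board : ℕ → ℕ → Pos → Set
Board p q c = proj₁ c < p × proj₂ c < q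

Leaps : ℕ → ℕ → Rel Pos 0ℓ
Leaps a b c c′ =
  (∣ proj₁ c - proj₁ c′ ∣ ≡ a × ∣ proj₂ c - proj₂ c′ ∣ ≡ b)
  ⊎ (∣ proj₁ c - proj₁ c′ ∣ ≡ b × ∣ proj₂ c - proj₂ c′ ∣ ≡ a)

leaps? : ∀ a b → Decidable (Leaps a b)
leaps? a b c c′ =
  ((∣ proj₁ c - proj₁ c′ ∣ ≟ a) ×-dec (∣ proj₂ c - proj₂ c′ ∣ ≟ b))
  ⊎-dec ((∣ proj₁ c - proj₁ c′ ∣ ≟ b) ×-dec (∣ proj₂ c - proj₂ c′ ∣ ≟ a))

shift : ℕ → Pos → Pos
shift d c = proj₁ c , d + proj₂ c

shift-injective : ∀ d → Injective _≡_ _≡_ (shift d)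
shift-injective d e = cong₂ _,_ (cong proj₁ e) (+-cancelˡ-≡ d _ _ (cong proj₂ e))

∣m+n-m+o∣≡∣n-o∣ : ∀ m n o → ∣ m + n - m + o ∣ ≡ ∣ n - o ∣
∣m+n-m+o∣≡∣n-o∣ m n o = cong₂ _+_ ([m+n]∸[m+o]≡n∸o m n o) ([m+n]∸[m+o]≡n∸o m o n)

Leaps-shift : ∀ {a b} d {c c′} → Leaps a b c c′ → Leaps a b (shift d c) (shift d c′)
Leaps-shift d {c} {c′} rewrite ∣m+n-m+o∣≡∣n-o∣ d (proj₂ c) (proj₂ c′) = id

column : ℕ → ℕ → List Pos
column p y = map (_, y) (upTo p)

cells : ℕ → ℕ → List Pos
cells p zero    = []
cells p (suc q) = column p 0 ++ map (shift 1) (cells p q)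

cells-widen : ∀ p d q → cells p (d + q) ≡ cells p d ++ map (shift d) (cells p q)
cells-widen p zero    q = sym (map-id (cells p q))
cells-widen p (suc d) q = begin
  column p 0 ++ map (shift 1) (cells p (d + q))
    ≡⟨ cong (λ cs → column p 0 ++ map (shift 1) cs) (cells-widen p d q) ⟩
  column p 0 ++ map (shift 1) (cells p d ++ map (shift d) (cells p q))
    ≡⟨ cong (column p 0 ++_) (map-++ (shift 1) (cells p d) _) ⟩
  column p 0 ++ (map (shift 1) (cells p d) ++ map (shift 1) (map (shift d) (cells p q)))
    ≡⟨ cong (λ cs → column p 0 ++ (map (shift 1) (cells p d) ++ cs)) (map-∘ (cells p q)) ⟨
  column p 0 ++ (map (shift 1) (cells p d) ++ map (shift (suc d)) (cells p q))
    ≡⟨ ++-assoc (column p 0) _ _ ⟨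
  cells p (suc d) ++ map (shift (suc d)) (cells p q) ∎
  where open ≡-Reasoning

length-cells : ∀ p q → length (cells p q) ≡ p * q
length-cells p zero    = sym (*-zeroʳ p)
length-cells p (suc q) = begin
  length (column p 0 ++ map (shift 1) (cells p q))
    ≡⟨ length-++ (column p 0) ⟩
  length (column p 0) + length (map (shift 1) (cells p q))
    ≡⟨ cong₂ _+_ (trans (length-map _ (upTo p)) (length-upTo p))
                 (trans (length-map _ (cells p q)) (length-cells p q)) ⟩
  p + p * q
    ≡⟨ *-suc p q ⟨
  p * suc q ∎
  where open ≡-Reasoning

cells-unique : ∀ p q → Unique (cells p q)
cells-unique p zero    = []
cells-unique p (suc q) =
  Unique.++⁺ (Unique.map⁺ (cong proj₁) (Unique.upTo⁺ p))
             (Unique.map⁺ (shift-injective 1) (cells-unique p q))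
             column-disjoint
  where
  column-disjoint : ∀ {c} → c ∈ column p 0 × c ∈ map (shift 1) (cells p q) → ⊥
  column-disjoint (c∈col , c∈rest) with _ , _ , refl ← ∈-map⁻ (_, 0) c∈col
                                | _ , _ , ()   ← ∈-map⁻ (shift 1) c∈rest

cells⊆Board : ∀ p q → All (Board p q) (cells p q)
cells⊆Board p zero    = []
cells⊆Board p (suc q) =
  All.++⁺ (All.map⁺ (All.applyUpTo⁺₁ id p (_, z<s)))
          (All.map⁺ (All.map (λ (x<p , y<q) → x<p , s<s y<q) (cells⊆Board p q)))

∈-cells⁺ : ∀ {p q x y} → x < p → y < q → (x , y) ∈ cells p q
∈-cells⁺ {p} {suc q} {y = zero}  x<p _   = ∈-++⁺ˡ (∈-map⁺ (_, 0) (∈-upTo⁺ x<p))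
∈-cells⁺ {p} {suc q} {y = suc y} x<p y<q =
  ∈-++⁺ʳ (column p 0) (∈-map⁺ (shift 1) (∈-cells⁺ x<p (s<s⁻¹ y<q)))

toPos : ∀ {p q} → Cell p q → Pos
toPos (x , y) = toℕ x , toℕ y

toPos-injective : ∀ {p q} → Injective _≡_ _≡_ (toPos {p} {q})
toPos-injective e = cong₂ _,_ (toℕ-injective (cong proj₁ e)) (toℕ-injective (cong proj₂ e))

toCell : ∀ {p q} (c : Pos) → Board p q c → Cell p q
toCell c (x<p , y<q) = fromℕ< x<p , fromℕ< y<q

toPos-toCell : ∀ {p q} c (c∈ : Board p q c) → toPos (toCell c c∈) ≡ c
toPos-toCell c (x<p , y<q) = cong₂ _,_ (toℕ-fromℕ< x<p) (toℕ-fromℕ< y<q)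

knightTour : ∀ {a b p q s t} (cs : List Pos) → cs ↭ cells p q →
             Walk (Leaps a b) s t cs → Leaps a b t s → KnightTour a b p q
knightTour {a} {b} {p} {q} cs cs↭cells walk t↝s = record
  { tour     = tour
  ; injTour  = injective
  ; surjTour = surjective
  ; adjTour  = adjacent
  }
  where
  length≡ : length cs ≡ p * q
  length≡ = trans (↭-length cs↭cells) (length-cells p q)

  index : Fin (p * q) → Fin (length cs)
  index = cast (sym length≡)

  onBoard : ∀ j → Board p q (lookup cs j)
  onBoard j = All.lookup (cells⊆Board p q) (∈-resp-↭ cs↭cells (∈-lookup j))

  tour : Fin (p * q) → Cell p q
  tour i = toCell (lookup cs (index i)) (onBoard (index i))

  toPos-tour : ∀ i → toPos (tour i) ≡ lookup cs (index i)
  toPos-tour i = toPos-toCell (lookup cs (index i)) (onBoard (index i))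

  injective : Injective _≡_ _≡_ tour
  injective {i} {j} e = begin
    i                        ≡⟨ cast-involutive length≡ (sym length≡) i ⟨
    cast length≡ (index i)  ≡⟨ cong (cast length≡) (lookup-injective unique lookup≡) ⟩
    cast length≡ (index j)  ≡⟨ cast-involutive length≡ (sym length≡) j ⟩
    j                        ∎
    where
    open ≡-Reasoning
    unique : Unique cs
    unique = Unique-resp-↭ (setoid Pos) (↭⇒↭ₛ (↭-sym cs↭cells)) (cells-unique p q)
    lookup≡ : lookup cs (index i) ≡ lookup cs (index j)
    lookup≡ = trans (sym (toPos-tour i)) (trans (cong toPos e) (toPos-tour j))

  surjective : Surjective _≡_ _≡_ tour
  surjective c@(x , y) = cast length≡ k , λ { refl → toPos-injective (begin
      toPos (tour (cast length≡ k))           ≡⟨ toPos-tour (cast length≡ k) ⟩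
      lookup cs (index (cast length≡ k))     ≡⟨ cong (lookup cs) (cast-involutive (sym length≡) length≡ k) ⟩
      lookup cs k                             ≡⟨ lookup-index c∈cs ⟨
      toPos c                                 ∎) }
    where
    open ≡-Reasoning
    c∈cs : toPos c ∈ cs
    c∈cs = ∈-resp-↭ (↭-sym cs↭cells) (∈-cells⁺ (toℕ<n x) (toℕ<n y))
    k : Fin (length cs)
    k = Any.index c∈cs

  -- Leap a b c c′ on cells is by definition Leaps a b (toPos c) (toPos c′).
  adjacent : ∀ i → Leap a b (tour i) (tour (cycSuc i))
  adjacent i =
    subst₂ (Leaps a b) (sym (toPos-tour i)) (sym (toPos-tour (cycSuc i)))
      (subst (Leaps a b (lookup cs (index i)) ∘ lookup cs) (sym (cast-cycSuc (sym length≡) i))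
        (walk-lookup-cycSuc walk t↝s (index i)))

sort-≡⇒↭ : ∀ {xs ys} → sort xs ≡ sort ys → xs ↭ ys
sort-≡⇒↭ {xs} {ys} e = ↭-trans (↭-sym (sort-↭ xs)) (subst (_↭ ys) (sym e) (sort-↭ ys))

anchor : List Pos
anchor =
  (8 , 1) ∷ (3 , 3) ∷ (1 , 8) ∷ (6 , 6) ∷ (1 , 4) ∷ (6 , 2) ∷ (1 , 0) ∷ (3 , 5) ∷ (1 , 10) ∷ (3 , 15) ∷
  (1 , 20) ∷ (3 , 25) ∷ (1 , 30) ∷ (3 , 35) ∷ (5 , 30) ∷ (0 , 28) ∷ (2 , 23) ∷ (7 , 21) ∷ (5 , 16) ∷ (7 , 11) ∷
  (12 , 9) ∷ (14 , 4) ∷ (19 , 6) ∷ (17 , 1) ∷ (12 , 3) ∷ (7 , 1) ∷ (2 , 3) ∷ (0 , 8) ∷ (2 , 13) ∷ (0 , 18) ∷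
  (5 , 20) ∷ (7 , 15) ∷ (5 , 10) ∷ (0 , 12) ∷ (5 , 14) ∷ (0 , 16) ∷ (2 , 21) ∷ (0 , 26) ∷ (5 , 24) ∷ (0 , 22) ∷
  (2 , 27) ∷ (7 , 25) ∷ (9 , 20) ∷ (4 , 18) ∷ (6 , 23) ∷ (1 , 25) ∷ (3 , 20) ∷ (8 , 22) ∷ (6 , 27) ∷ (4 , 22) ∷
  (2 , 17) ∷ (4 , 12) ∷ (6 , 17) ∷ (1 , 19) ∷ (6 , 21) ∷ (4 , 16) ∷ (9 , 14) ∷ (11 , 9) ∷ (9 , 4) ∷ (4 , 2) ∷
  (2 , 7) ∷ (7 , 9) ∷ (12 , 7) ∷ (7 , 5) ∷ (5 , 0) ∷ (0 , 2) ∷ (5 , 4) ∷ (0 , 6) ∷ (5 , 8) ∷ (0 , 10) ∷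
  (2 , 15) ∷ (7 , 17) ∷ (9 , 22) ∷ (11 , 17) ∷ (16 , 19) ∷ (14 , 14) ∷ (19 , 12) ∷ (17 , 17) ∷ (15 , 12) ∷ (17 , 7) ∷
  (19 , 2) ∷ (14 , 0) ∷ (12 , 5) ∷ (7 , 7) ∷ (5 , 12) ∷ (0 , 14) ∷ (2 , 19) ∷ (4 , 14) ∷ (9 , 16) ∷ (11 , 21) ∷
  (13 , 16) ∷ (18 , 14) ∷ (13 , 12) ∷ (8 , 14) ∷ (10 , 9) ∷ (15 , 11) ∷ (17 , 16) ∷ (12 , 14) ∷ (7 , 16) ∷ (12 , 18) ∷
  (17 , 20) ∷ (15 , 25) ∷ (10 , 23) ∷ (8 , 18) ∷ (10 , 13) ∷ (5 , 11) ∷ (0 , 13) ∷ (2 , 18) ∷ (7 , 20) ∷ (12 , 22) ∷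
  (10 , 17) ∷ (12 , 12) ∷ (14 , 7) ∷ (19 , 5) ∷ (17 , 0) ∷ (15 , 5) ∷ (10 , 7) ∷ (5 , 5) ∷ (3 , 0) ∷ (1 , 5) ∷
  (6 , 7) ∷ (8 , 12) ∷ (3 , 14) ∷ (1 , 9) ∷ (3 , 4) ∷ (8 , 2) ∷ (13 , 4) ∷ (18 , 6) ∷ (16 , 11) ∷ (11 , 13) ∷
  (13 , 8) ∷ (18 , 10) ∷ (16 , 5) ∷ (18 , 0) ∷ (13 , 2) ∷ (8 , 0) ∷ (6 , 5) ∷ (1 , 7) ∷ (3 , 2) ∷ (8 , 4) ∷
  (6 , 9) ∷ (11 , 11) ∷ (16 , 9) ∷ (18 , 4) ∷ (13 , 6) ∷ (8 , 8) ∷ (10 , 3) ∷ (15 , 1) ∷ (17 , 6) ∷ (19 , 1) ∷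
  (14 , 3) ∷ (12 , 8) ∷ (17 , 10) ∷ (15 , 15) ∷ (13 , 10) ∷ (18 , 8) ∷ (16 , 13) ∷ (18 , 18) ∷ (16 , 23) ∷ (18 , 28) ∷
  (13 , 30) ∷ (18 , 32) ∷ (16 , 27) ∷ (11 , 25) ∷ (13 , 20) ∷ (18 , 22) ∷ (16 , 17) ∷ (11 , 15) ∷ (9 , 10) ∷ (4 , 8) ∷
  (6 , 3) ∷ (1 , 1) ∷ (3 , 6) ∷ (5 , 1) ∷ (0 , 3) ∷ (2 , 8) ∷ (7 , 10) ∷ (5 , 15) ∷ (3 , 10) ∷ (1 , 15) ∷
  (6 , 13) ∷ (1 , 11) ∷ (3 , 16) ∷ (1 , 21) ∷ (6 , 19) ∷ (4 , 24) ∷ (2 , 29) ∷ (7 , 27) ∷ (2 , 25) ∷ (4 , 20) ∷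
  (9 , 18) ∷ (11 , 23) ∷ (16 , 21) ∷ (18 , 16) ∷ (13 , 18) ∷ (18 , 20) ∷ (16 , 15) ∷ (14 , 20) ∷ (12 , 15) ∷ (17 , 13) ∷
  (19 , 18) ∷ (14 , 16) ∷ (12 , 11) ∷ (7 , 13) ∷ (2 , 11) ∷ (4 , 6) ∷ (2 , 1) ∷ (7 , 3) ∷ (12 , 1) ∷ (17 , 3) ∷
  (19 , 8) ∷ (14 , 10) ∷ (9 , 8) ∷ (4 , 10) ∷ (9 , 12) ∷ (11 , 7) ∷ (9 , 2) ∷ (4 , 0) ∷ (2 , 5) ∷ (0 , 0) ∷
  (5 , 2) ∷ (10 , 0) ∷ (15 , 2) ∷ (10 , 4) ∷ (8 , 9) ∷ (6 , 14) ∷ (1 , 16) ∷ (3 , 11) ∷ (5 , 6) ∷ (0 , 4) ∷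
  (2 , 9) ∷ (4 , 4) ∷ (9 , 6) ∷ (11 , 1) ∷ (16 , 3) ∷ (14 , 8) ∷ (19 , 10) ∷ (14 , 12) ∷ (19 , 14) ∷ (17 , 9) ∷
  (19 , 4) ∷ (14 , 6) ∷ (16 , 1) ∷ (11 , 3) ∷ (6 , 1) ∷ (1 , 3) ∷ (3 , 8) ∷ (1 , 13) ∷ (6 , 11) ∷ (8 , 6) ∷
  (10 , 1) ∷ (15 , 3) ∷ (17 , 8) ∷ (19 , 3) ∷ (14 , 1) ∷ (12 , 6) ∷ (7 , 8) ∷ (5 , 3) ∷ (0 , 1) ∷ (2 , 6) ∷
  (4 , 1) ∷ (9 , 3) ∷ (11 , 8) ∷ (16 , 10) ∷ (18 , 5) ∷ (13 , 7) ∷ (11 , 12) ∷ (9 , 7) ∷ (11 , 2) ∷ (16 , 0) ∷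
  (14 , 5) ∷ (12 , 10) ∷ (14 , 15) ∷ (19 , 13) ∷ (17 , 18) ∷ (15 , 13) ∷ (10 , 15) ∷ (8 , 10) ∷ (6 , 15) ∷ (1 , 17) ∷
  (3 , 12) ∷ (5 , 17) ∷ (0 , 19) ∷ (5 , 21) ∷ (0 , 23) ∷ (5 , 25) ∷ (0 , 27) ∷ (5 , 29) ∷ (7 , 24) ∷ (5 , 19) ∷
  (0 , 17) ∷ (2 , 22) ∷ (4 , 27) ∷ (6 , 32) ∷ (11 , 34) ∷ (9 , 29) ∷ (11 , 24) ∷ (6 , 22) ∷ (4 , 17) ∷ (6 , 12) ∷
  (11 , 14) ∷ (9 , 19) ∷ (7 , 14) ∷ (5 , 9) ∷ (0 , 7) ∷ (2 , 12) ∷ (4 , 7) ∷ (9 , 9) ∷ (11 , 4) ∷ (16 , 2) ∷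
  (11 , 0) ∷ (13 , 5) ∷ (15 , 0) ∷ (17 , 5) ∷ (19 , 0) ∷ (14 , 2) ∷ (9 , 0) ∷ (11 , 5) ∷ (13 , 0) ∷ (18 , 2) ∷
  (16 , 7) ∷ (18 , 12) ∷ (13 , 14) ∷ (8 , 16) ∷ (10 , 11) ∷ (15 , 9) ∷ (17 , 4) ∷ (12 , 2) ∷ (7 , 4) ∷ (2 , 2) ∷
  (7 , 0) ∷ (9 , 5) ∷ (4 , 3) ∷ (9 , 1) ∷ (7 , 6) ∷ (12 , 4) ∷ (17 , 2) ∷ (15 , 7) ∷ (10 , 5) ∷ (12 , 0) ∷
  (7 , 2) ∷ (2 , 4) ∷ (0 , 9) ∷ (5 , 7) ∷ (0 , 5) ∷ (2 , 0) ∷ (4 , 5) ∷ (6 , 0) ∷ (1 , 2) ∷ (6 , 4) ∷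
  (1 , 6) ∷ (3 , 1) ∷ (8 , 3) ∷ (13 , 1) ∷ (18 , 3) ∷ (16 , 8) ∷ []

fillerBase : List Pos
fillerBase =
  (18 , 13) ∷ (13 , 11) ∷ (15 , 6) ∷ (17 , 11) ∷ (19 , 16) ∷ (14 , 18) ∷ (12 , 23) ∷ (17 , 21) ∷ (15 , 26) ∷ (10 , 28) ∷
  (8 , 23) ∷ (3 , 21) ∷ (1 , 26) ∷ (6 , 28) ∷ (4 , 33) ∷ (2 , 38) ∷ (0 , 43) ∷ (5 , 41) ∷ (10 , 43) ∷ (8 , 38) ∷
  (13 , 36) ∷ (15 , 31) ∷ (10 , 33) ∷ (8 , 28) ∷ (6 , 33) ∷ (1 , 35) ∷ (3 , 30) ∷ (8 , 32) ∷ (13 , 34) ∷ (15 , 29) ∷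
  (10 , 27) ∷ (12 , 32) ∷ (14 , 37) ∷ (19 , 35) ∷ (14 , 33) ∷ (12 , 38) ∷ (14 , 43) ∷ (19 , 41) ∷ (14 , 39) ∷ (19 , 37) ∷
  (17 , 42) ∷ (12 , 40) ∷ (10 , 35) ∷ (15 , 33) ∷ (17 , 38) ∷ (19 , 43) ∷ (14 , 41) ∷ (19 , 39) ∷ (17 , 34) ∷ (15 , 39) ∷
  (10 , 37) ∷ (12 , 42) ∷ (17 , 40) ∷ (15 , 35) ∷ (17 , 30) ∷ (12 , 28) ∷ (7 , 30) ∷ (2 , 32) ∷ (0 , 37) ∷ (2 , 42) ∷
  (7 , 40) ∷ (9 , 35) ∷ (4 , 37) ∷ (9 , 39) ∷ (4 , 41) ∷ (9 , 43) ∷ (11 , 38) ∷ (16 , 40) ∷ (18 , 35) ∷ (16 , 30) ∷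
  (18 , 25) ∷ (16 , 20) ∷ (18 , 15) ∷ (13 , 13) ∷ (18 , 11) ∷ (16 , 16) ∷ (18 , 21) ∷ (16 , 26) ∷ (11 , 28) ∷ (9 , 33) ∷
  (4 , 35) ∷ (2 , 40) ∷ (7 , 42) ∷ (5 , 37) ∷ (0 , 39) ∷ (2 , 34) ∷ (4 , 39) ∷ (6 , 34) ∷ (8 , 39) ∷ (3 , 41) ∷
  (1 , 36) ∷ (3 , 31) ∷ (8 , 33) ∷ (13 , 35) ∷ (18 , 33) ∷ (16 , 28) ∷ (11 , 26) ∷ (6 , 24) ∷ (8 , 29) ∷ (13 , 27) ∷
  (8 , 25) ∷ (10 , 30) ∷ (12 , 35) ∷ (7 , 37) ∷ (12 , 39) ∷ (14 , 34) ∷ (19 , 36) ∷ (17 , 31) ∷ (15 , 36) ∷ (17 , 41) ∷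
  (12 , 43) ∷ (7 , 41) ∷ (2 , 43) ∷ (0 , 38) ∷ (5 , 40) ∷ (0 , 42) ∷ (2 , 37) ∷ (0 , 32) ∷ (5 , 34) ∷ (0 , 36) ∷
  (2 , 31) ∷ (4 , 36) ∷ (6 , 41) ∷ (1 , 43) ∷ (3 , 38) ∷ (8 , 36) ∷ (10 , 31) ∷ (12 , 26) ∷ (7 , 28) ∷ (12 , 30) ∷
  (14 , 35) ∷ (19 , 33) ∷ (17 , 28) ∷ (15 , 23) ∷ (10 , 25) ∷ (12 , 20) ∷ (7 , 18) ∷ (12 , 16) ∷ (14 , 21) ∷ (19 , 23) ∷
  (14 , 25) ∷ (19 , 27) ∷ (17 , 22) ∷ (15 , 17) ∷ (10 , 19) ∷ (15 , 21) ∷ (13 , 26) ∷ (18 , 24) ∷ (16 , 29) ∷ (11 , 31) ∷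
  (9 , 26) ∷ (4 , 28) ∷ (2 , 33) ∷ (7 , 35) ∷ (12 , 33) ∷ (17 , 35) ∷ (15 , 40) ∷ (10 , 42) ∷ (8 , 37) ∷ (3 , 39) ∷
  (1 , 34) ∷ (6 , 36) ∷ (1 , 38) ∷ (3 , 43) ∷ (5 , 38) ∷ (0 , 40) ∷ (5 , 42) ∷ (3 , 37) ∷ (1 , 42) ∷ (6 , 40) ∷
  (11 , 42) ∷ (9 , 37) ∷ (11 , 32) ∷ (6 , 30) ∷ (1 , 32) ∷ (3 , 27) ∷ (1 , 22) ∷ (6 , 20) ∷ (11 , 18) ∷ (13 , 23) ∷
  (15 , 18) ∷ (10 , 16) ∷ (8 , 11) ∷ (3 , 13) ∷ (8 , 15) ∷ (10 , 10) ∷ (15 , 8) ∷ (10 , 6) ∷ (15 , 4) ∷ (10 , 2) ∷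
  (8 , 7) ∷ (3 , 9) ∷ (1 , 14) ∷ (3 , 19) ∷ (1 , 24) ∷ (3 , 29) ∷ (8 , 31) ∷ (10 , 26) ∷ (15 , 28) ∷ (17 , 33) ∷
  (19 , 38) ∷ (14 , 40) ∷ (19 , 42) ∷ (17 , 37) ∷ (19 , 32) ∷ (14 , 30) ∷ (16 , 25) ∷ (18 , 30) ∷ (16 , 35) ∷ (18 , 40) ∷
  (13 , 42) ∷ (15 , 37) ∷ (17 , 32) ∷ (15 , 27) ∷ (10 , 29) ∷ (5 , 27) ∷ (0 , 29) ∷ (5 , 31) ∷ (3 , 36) ∷ (1 , 41) ∷
  (6 , 43) ∷ (4 , 38) ∷ (9 , 36) ∷ (4 , 34) ∷ (2 , 39) ∷ (0 , 34) ∷ (5 , 32) ∷ (0 , 30) ∷ (5 , 28) ∷ (7 , 23) ∷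
  (12 , 25) ∷ (17 , 23) ∷ (19 , 28) ∷ (14 , 26) ∷ (19 , 24) ∷ (17 , 19) ∷ (12 , 21) ∷ (7 , 19) ∷ (12 , 17) ∷ (14 , 22) ∷
  (19 , 20) ∷ (17 , 15) ∷ (15 , 20) ∷ (13 , 15) ∷ (11 , 10) ∷ (9 , 15) ∷ (4 , 13) ∷ (6 , 8) ∷ (8 , 13) ∷ (6 , 18) ∷
  (4 , 23) ∷ (2 , 28) ∷ (0 , 33) ∷ (5 , 35) ∷ (3 , 40) ∷ (8 , 42) ∷ (13 , 40) ∷ (18 , 42) ∷ (16 , 37) ∷ (14 , 42) ∷
  (19 , 40) ∷ (14 , 38) ∷ (16 , 43) ∷ (18 , 38) ∷ (16 , 33) ∷ (14 , 28) ∷ (19 , 26) ∷ (14 , 24) ∷ (19 , 22) ∷ (17 , 27) ∷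
  (15 , 32) ∷ (10 , 34) ∷ (5 , 36) ∷ (10 , 38) ∷ (8 , 43) ∷ (13 , 41) ∷ (18 , 43) ∷ (16 , 38) ∷ (11 , 36) ∷ (13 , 31) ∷
  (18 , 29) ∷ (16 , 34) ∷ (18 , 39) ∷ (13 , 37) ∷ (15 , 42) ∷ (10 , 40) ∷ (8 , 35) ∷ (3 , 33) ∷ (1 , 28) ∷ (3 , 23) ∷
  (1 , 18) ∷ (6 , 16) ∷ (4 , 21) ∷ (9 , 23) ∷ (4 , 25) ∷ (2 , 20) ∷ (0 , 25) ∷ (5 , 23) ∷ (0 , 21) ∷ (2 , 26) ∷
  (4 , 31) ∷ (6 , 26) ∷ (8 , 21) ∷ (13 , 19) ∷ (8 , 17) ∷ (10 , 22) ∷ (15 , 24) ∷ (13 , 29) ∷ (8 , 27) ∷ (10 , 32) ∷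
  (15 , 30) ∷ (17 , 25) ∷ (19 , 30) ∷ (14 , 32) ∷ (19 , 34) ∷ (14 , 36) ∷ (12 , 41) ∷ (17 , 43) ∷ (15 , 38) ∷ (13 , 33) ∷
  (18 , 31) ∷ (16 , 36) ∷ (14 , 31) ∷ (19 , 29) ∷ (14 , 27) ∷ (19 , 25) ∷ (14 , 23) ∷ (19 , 21) ∷ (17 , 26) ∷ (12 , 24) ∷
  (7 , 22) ∷ (9 , 17) ∷ (7 , 12) ∷ (2 , 10) ∷ (0 , 15) ∷ (5 , 13) ∷ (0 , 11) ∷ (2 , 16) ∷ (4 , 11) ∷ (9 , 13) ∷
  (4 , 15) ∷ (6 , 10) ∷ (8 , 5) ∷ (3 , 7) ∷ (1 , 12) ∷ (3 , 17) ∷ (8 , 19) ∷ (10 , 14) ∷ (12 , 19) ∷ (10 , 24) ∷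
  (12 , 29) ∷ (7 , 31) ∷ (5 , 26) ∷ (0 , 24) ∷ (5 , 22) ∷ (0 , 20) ∷ (5 , 18) ∷ (10 , 20) ∷ (15 , 22) ∷ (13 , 17) ∷
  (18 , 19) ∷ (16 , 14) ∷ (18 , 9) ∷ (16 , 4) ∷ (11 , 6) ∷ (9 , 11) ∷ (4 , 9) ∷ (2 , 14) ∷ (4 , 19) ∷ (9 , 21) ∷
  (11 , 16) ∷ (16 , 18) ∷ (11 , 20) ∷ (9 , 25) ∷ (11 , 30) ∷ (16 , 32) ∷ (18 , 27) ∷ (13 , 25) ∷ (18 , 23) ∷ (13 , 21) ∷
  (15 , 16) ∷ (10 , 18) ∷ (12 , 13) ∷ (10 , 8) ∷ (15 , 10) ∷ (10 , 12) ∷ (15 , 14) ∷ (13 , 9) ∷ (18 , 7) ∷ (16 , 12) ∷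
  (18 , 17) ∷ (16 , 22) ∷ (14 , 17) ∷ (19 , 15) ∷ (14 , 13) ∷ (19 , 11) ∷ (14 , 9) ∷ (19 , 7) ∷ (17 , 12) ∷ (19 , 17) ∷
  (14 , 19) ∷ (16 , 24) ∷ (11 , 22) ∷ (9 , 27) ∷ (4 , 29) ∷ (2 , 24) ∷ (7 , 26) ∷ (9 , 31) ∷ (7 , 36) ∷ (9 , 41) ∷
  (4 , 43) ∷ (6 , 38) ∷ (1 , 40) ∷ (6 , 42) ∷ (11 , 40) ∷ (16 , 42) ∷ (18 , 37) ∷ (13 , 39) ∷ (18 , 41) ∷ (13 , 43) ∷
  (8 , 41) ∷ (10 , 36) ∷ (12 , 31) ∷ (7 , 29) ∷ (12 , 27) ∷ (17 , 29) ∷ (15 , 34) ∷ (17 , 39) ∷ (12 , 37) ∷ (7 , 39) ∷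
  (2 , 41) ∷ (7 , 43) ∷ (9 , 38) ∷ (11 , 43) ∷ (13 , 38) ∷ (15 , 43) ∷ (10 , 41) ∷ (5 , 39) ∷ (7 , 34) ∷ (12 , 36) ∷
  (7 , 38) ∷ (5 , 43) ∷ (0 , 41) ∷ (2 , 36) ∷ (0 , 31) ∷ (5 , 33) ∷ (0 , 35) ∷ (2 , 30) ∷ (7 , 32) ∷ (12 , 34) ∷
  (14 , 29) ∷ (19 , 31) ∷ (17 , 36) ∷ (15 , 41) ∷ (10 , 39) ∷ (8 , 34) ∷ (3 , 32) ∷ (8 , 30) ∷ (13 , 32) ∷ (18 , 34) ∷
  (16 , 39) ∷ (11 , 41) ∷ (6 , 39) ∷ (1 , 37) ∷ (3 , 42) ∷ (8 , 40) ∷ (6 , 35) ∷ (11 , 33) ∷ (13 , 28) ∷ (18 , 26) ∷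
  (13 , 24) ∷ (11 , 19) ∷ (9 , 24) ∷ (4 , 26) ∷ (9 , 28) ∷ (7 , 33) ∷ (2 , 35) ∷ (4 , 40) ∷ (9 , 42) ∷ (11 , 37) ∷
  (9 , 32) ∷ (4 , 30) ∷ (6 , 25) ∷ (1 , 27) ∷ (3 , 22) ∷ (8 , 24) ∷ (3 , 26) ∷ (1 , 31) ∷ (6 , 29) ∷ (11 , 27) ∷
  (13 , 22) ∷ (8 , 20) ∷ (3 , 18) ∷ (1 , 23) ∷ (3 , 28) ∷ (1 , 33) ∷ (6 , 31) ∷ (11 , 29) ∷ (16 , 31) ∷ (18 , 36) ∷
  (16 , 41) ∷ (11 , 39) ∷ (9 , 34) ∷ (4 , 32) ∷ (9 , 30) ∷ (11 , 35) ∷ (9 , 40) ∷ (4 , 42) ∷ (6 , 37) ∷ (1 , 39) ∷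
  (3 , 34) ∷ (1 , 29) ∷ (3 , 24) ∷ (8 , 26) ∷ (10 , 21) ∷ (15 , 19) ∷ (17 , 24) ∷ (19 , 19) ∷ (17 , 14) ∷ (19 , 9) ∷
  (14 , 11) ∷ (16 , 6) ∷ (18 , 1) ∷ (13 , 3) ∷ []

entry : List Pos
entry = (18 , 13) ∷ (16 , 18) ∷ []

exit : List Pos
exit =
  (18 , 15) ∷ (13 , 17) ∷ (15 , 22) ∷ (17 , 27) ∷ (19 , 22) ∷ (14 , 24) ∷ (12 , 19) ∷ (10 , 14) ∷ (8 , 19) ∷ (3 , 21) ∷
  (1 , 26) ∷ (6 , 24) ∷ (11 , 22) ∷ (9 , 17) ∷ (7 , 12) ∷ (2 , 14) ∷ (4 , 9) ∷ (9 , 11) ∷ (4 , 13) ∷ (9 , 15) ∷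
  (14 , 17) ∷ (19 , 15) ∷ (14 , 13) ∷ (19 , 11) ∷ (14 , 9) ∷ (19 , 7) ∷ (17 , 12) ∷ (15 , 17) ∷ (13 , 22) ∷ (18 , 24) ∷
  (13 , 26) ∷ (8 , 24) ∷ (10 , 19) ∷ (15 , 21) ∷ (17 , 26) ∷ (12 , 24) ∷ (7 , 26) ∷ (2 , 28) ∷ (7 , 30) ∷ (12 , 28) ∷
  (10 , 33) ∷ (15 , 35) ∷ (17 , 30) ∷ (12 , 32) ∷ (10 , 27) ∷ (8 , 32) ∷ (3 , 30) ∷ (1 , 35) ∷ (6 , 37) ∷ (4 , 32) ∷
  (9 , 30) ∷ (4 , 28) ∷ (9 , 26) ∷ (7 , 31) ∷ (5 , 26) ∷ (0 , 24) ∷ (5 , 22) ∷ (0 , 20) ∷ (5 , 18) ∷ (7 , 23) ∷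
  (12 , 25) ∷ (17 , 23) ∷ (12 , 21) ∷ (14 , 26) ∷ (19 , 28) ∷ (14 , 30) ∷ (9 , 32) ∷ (4 , 34) ∷ (2 , 39) ∷ (7 , 37) ∷
  (2 , 35) ∷ (4 , 30) ∷ (9 , 28) ∷ (11 , 33) ∷ (16 , 31) ∷ (18 , 26) ∷ (13 , 28) ∷ (18 , 30) ∷ (16 , 25) ∷ (11 , 27) ∷
  (16 , 29) ∷ (11 , 31) ∷ (16 , 33) ∷ (18 , 38) ∷ (13 , 40) ∷ (18 , 42) ∷ (16 , 37) ∷ (11 , 35) ∷ (6 , 33) ∷ (8 , 28) ∷
  (3 , 26) ∷ (1 , 31) ∷ (6 , 29) ∷ (1 , 27) ∷ (6 , 25) ∷ (1 , 23) ∷ (3 , 18) ∷ (8 , 20) ∷ (3 , 22) ∷ (5 , 27) ∷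
  (0 , 29) ∷ (5 , 31) ∷ (0 , 33) ∷ (5 , 35) ∷ (0 , 37) ∷ (5 , 39) ∷ (7 , 34) ∷ (2 , 32) ∷ (4 , 37) ∷ (9 , 39) ∷
  (11 , 44) ∷ (6 , 42) ∷ (1 , 40) ∷ (3 , 45) ∷ (5 , 40) ∷ (0 , 38) ∷ (2 , 33) ∷ (7 , 35) ∷ (2 , 37) ∷ (0 , 32) ∷
  (5 , 34) ∷ (0 , 36) ∷ (2 , 31) ∷ (4 , 26) ∷ (6 , 31) ∷ (1 , 29) ∷ (3 , 24) ∷ (8 , 26) ∷ (13 , 24) ∷ (11 , 19) ∷
  (9 , 24) ∷ (7 , 19) ∷ (12 , 17) ∷ (17 , 19) ∷ (19 , 24) ∷ (14 , 22) ∷ (19 , 20) ∷ (17 , 15) ∷ (12 , 13) ∷ (14 , 18) ∷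
  (19 , 16) ∷ (17 , 11) ∷ (15 , 6) ∷ (10 , 8) ∷ (15 , 10) ∷ (13 , 15) ∷ (8 , 13) ∷ (13 , 11) ∷ (18 , 9) ∷ (16 , 4) ∷
  (11 , 6) ∷ (6 , 8) ∷ (11 , 10) ∷ (16 , 12) ∷ (18 , 7) ∷ (13 , 9) ∷ (15 , 4) ∷ (10 , 2) ∷ (8 , 7) ∷ (3 , 9) ∷
  (1 , 14) ∷ (6 , 16) ∷ (1 , 18) ∷ (3 , 13) ∷ (8 , 11) ∷ (10 , 6) ∷ (15 , 8) ∷ (10 , 10) ∷ (8 , 5) ∷ (3 , 7) ∷
  (1 , 12) ∷ (6 , 10) ∷ (4 , 15) ∷ (2 , 10) ∷ (0 , 15) ∷ (5 , 13) ∷ (0 , 11) ∷ (2 , 16) ∷ (4 , 11) ∷ (9 , 13) ∷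
  (11 , 18) ∷ (16 , 20) ∷ (14 , 25) ∷ (19 , 23) ∷ (17 , 28) ∷ (15 , 23) ∷ (10 , 25) ∷ (12 , 20) ∷ (7 , 18) ∷ (12 , 16) ∷
  (10 , 21) ∷ (15 , 19) ∷ (17 , 14) ∷ (19 , 9) ∷ (14 , 11) ∷ (16 , 6) ∷ (18 , 1) ∷ (13 , 3) ∷ []

_↝_ : Rel Pos 0ℓ
_↝_ = Leaps 2 5

anchor-walk : Walk _↝_ (8 , 1) (16 , 8) anchor
anchor-walk = record { steps = from-yes (linked? (leaps? 2 5) anchor) ; first = refl ; final = refl }

fillerBase-walk : Walk _↝_ (18 , 13) (13 , 3) fillerBase
fillerBase-walk = record { steps = from-yes (linked? (leaps? 2 5) fillerBase) ; first = refl ; final = refl }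

entry-walk : Walk _↝_ (18 , 13) (16 , 18) entry
entry-walk = record { steps = inj₁ (refl , refl) ∷ [-] ; first = refl ; final = refl }

exit-walk : Walk _↝_ (18 , 15) (13 , 3) exit
exit-walk = record { steps = from-yes (linked? (leaps? 2 5) exit) ; first = refl ; final = refl }

base-cells : anchor ++ fillerBase ↭ cells 20 44
base-cells = sort-≡⇒↭ refl

new-cells : anchor ++ entry ++ exit ↭ cells 20 10 ++ map (shift 10) anchor
new-cells = sort-≡⇒↭ refl

width : ℕ → ℕ
width m = m * 10 + 44

filler : ℕ → List Pos
filler zero    = fillerBase
filler (suc m) = entry ++ map (shift 10) (filler m) ++ exit

filler-walk : ∀ m → Walk _↝_ (18 , 13) (13 , 3) (filler m)
filler-walk zero    = fillerBase-walk
filler-walk (suc m) =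
  walk-++ entry-walk (inj₁ (refl , refl))
    (walk-++ (walk-map (λ {u} {v} → Leaps-shift 10 {u} {v}) (filler-walk m)) (inj₂ (refl , refl)) exit-walk)

anchor++filler↭cells : ∀ m → anchor ++ filler m ↭ cells 20 (width m)
anchor++filler↭cells zero    = base-cells
anchor++filler↭cells (suc m) = begin
  anchor ++ entry ++ shifted ++ exit
    ↭⟨ ++⁺ˡ anchor (++⁺ˡ entry (++-comm shifted exit)) ⟩
  anchor ++ entry ++ exit ++ shifted
    ≡⟨ ++-assoc anchor (entry ++ exit) shifted ⟨
  (anchor ++ entry ++ exit) ++ shifted
    ↭⟨ ++⁺ʳ {xs = anchor ++ entry ++ exit} shifted new-cells ⟩
  (cells 20 10 ++ map (shift 10) anchor) ++ shifted
    ≡⟨ ++-assoc (cells 20 10) (map (shift 10) anchor) shifted ⟩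
  cells 20 10 ++ map (shift 10) anchor ++ shifted
    ≡⟨ cong (cells 20 10 ++_) (map-++ (shift 10) anchor (filler m)) ⟨
  cells 20 10 ++ map (shift 10) (anchor ++ filler m)
    ↭⟨ ++⁺ˡ (cells 20 10) (Perm.map⁺ (shift 10) {xs = anchor ++ filler m} (anchor++filler↭cells m)) ⟩
  cells 20 10 ++ map (shift 10) (cells 20 (width m))
    ≡⟨ cells-widen 20 10 (width m) ⟨
  cells 20 (width (suc m)) ∎
  where
  open PermutationReasoning
  shifted : List Pos
  shifted = map (shift 10) (filler m)

width-eq : ∀ m → 10 * (4 + m) + 4 ≡ m * 10 + 44
width-eq = solve-∀

lemma18 : (k : ℕ) → 4 ≤ k → KnightTour 2 5 20 (10 * k + 4)
lemma18 k 4≤k with m , refl ← m≤n⇒∃[o]m+o≡n 4≤k =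
  subst (KnightTour 2 5 20) (sym (width-eq m))
    (knightTour (anchor ++ filler m) (anchor++filler↭cells m)
      (walk-++ anchor-walk (inj₁ (refl , refl)) (filler-walk m)) (inj₂ (refl , refl)))
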